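{- Let $\mathfrak{L}$ be a memory logic. Then the class of pointed memory models $\langle\mathcal{M},w\rangle$ with $\mathcal{M}$ $\omega$-saturated has the Hennessy–Milner property with respect to $\mathfrak{L}$-simulations: for any such $\langle\mathcal{M},w\rangle,\langle\mathcal{N},v\rangle$, if every $\mathfrak{L}$-formula true at $\mathcal{M},w$ is true at $\mathcal{N},v$, then $\langle\mathcal{M},w\rangle$ and $\langle\mathcal{N},v\rangle$ are related by some $\mathfrak{L}$-simulation.
   Context: Memory logics. Signature: a countably infinite set $\textsc{prop}$ of propositional symbols and one relation symbol $r$. A memory model is $\mathcal{M}=\langle W,R,V,S\rangle$ with $W\neq\emptyset$, $R\subseteq W\times W$, $V:\textsc{prop}\to\mathcal{P}(W)$, and memory $S\subseteq W$. Notation: $\mathcal{M}[w]=\langle W,R,V,S\cup\{w\}\rangle$, $\mathcal{M}[-w]=\langle W,R,V,S\setminus\{w\}\rangle$, $\mathcal{M}[*]=\langle W,R,V,\emptyset\rangle$. Formulas are built from propositional symbols, $\top,\bot,\neg,\wedge,\vee,\to,\leftrightarrow$ (classical semantics at a point) and the operators: $\mathcal{M},w\models \mathrm{k}$ iff $w\in S$; $\mathcal{M},w\models\mathrm{r}\varphi$ iff $\mathcal{M}[w],w\models\varphi$; $\mathcal{M},w\models\mathrm{f}\varphi$ iff $\mathcal{M}[-w],w\models\varphi$; $\mathcal{M},w\models\mathrm{e}\varphi$ iff $\mathcal{M}[*],w\models\varphi$; $\mathcal{M},w\models\langle r\rangle\varphi$ iff some $w'$ with $wRw'$ has $\mathcal{M},w'\models\varphi$;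 $\mathcal{M},w\models\langle\langle r\rangle\rangle\varphi$ iff some $w'$ with $wRw'$ has $\mathcal{M}[w],w'\models\varphi$. A memory logic is the logic with the propositional connectives, $\mathrm{k}$, $\mathrm{r}$, and any subset of $\{\mathrm{f},\mathrm{e},\langle r\rangle,\langle\langle r\rangle\rangle\}$. An $\mathfrak{L}$-simulation is a relation $\sim$ between pointed memory models satisfying: (nontriv) $\sim\neq\emptyset$; (agree) related points satisfy the same propositional symbols; (kagree) if $\langle\mathcal{M},m\rangle\sim\langle\mathcal{N},n\rangle$ then $m\in S^{\mathcal{M}}$ iff $n\in S^{\mathcal{N}}$; and for each operator of $\mathfrak{L}$ the corresponding clause: r: $\langle\mathcal{M}[m],m\rangle\sim\langle\mathcal{N}[n],n\rangle$; f: $\langle\mathcal{M}[-m],m\rangle\sim\langle\mathcal{N}[-n],n\rangle$; e: $\langle\mathcal{M}[*],m\rangle\sim\langle\mathcal{N}[*],n\rangle$; $\langle r\rangle$: (forth) if $mR^{\mathcal{M}}m'$ there is $n'$ with $nR^{\mathcal{N}}n'$ and $\langle\mathcal{M},m'\rangle\sim\langle\mathcal{N},n'\rangle$, and (back) symmetrically; $\langle\langle r\rangle\rangle$: (mforth) if $mR^{\mathcal{M}}m'$ there is $n'$ with $nR^{\mathcal{N}}n'$ and $\langle\mathcal{M}[m],m'\rangle\sim\langle\mathcal{N}[n],n'\rangle$, and (mback) symmetrically (each clause holding whenever $\langle\mathcal{M},m\rangle\sim\langle\mathcal{N},n\rangle$). The first-order translation of $\langle\mathcal{M},w\rangle$ is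 the first-order structure with domain $W$, binary $R$, unary $P_i=V(p_i)$ and unary $K=S$, with $x$ assigned $w$. A memory model is $\omega$-saturated iff this first-order structure is $\omega$-saturated (for every finite set $A$ of elements, every set of formulas in one free variable with parameters from $A$ that is finitely realized is realized). -}

module Defs where

open import Level using (Level; 0ℓ) renaming (suc to lsuc)
open import Data.Nat using (ℕ; zero; suc)
open import Data.Fin using (Fin)
open import Data.Bool using (Bool; T)
open import Data.Empty using (⊥)
open import Data.Unit using (⊤)
open import Data.Product using (Σ; _×_; _,_; ∃)
open import Data.Sum using (_⊎_)
open import Data.List using (List)
open import Data.List.Relation.Unary.All using (All)
open import Data.Vec.Functional using (Vector; _∷_)
open import Relation.Nullary using (¬_)
open import Relation.Binary.PropositionalEquality using (_≡_; _≢_)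
open import Function.Bundles using (_⇔_)

record Model : Set₁ where
  field
    W : Set
    R : W → W → Set
    V : ℕ → W → Set
    S : W → Set
open Model public

remember : (M : Model) → W M → Model
remember M w = record { W = W M ; R = R M ; V = V M ; S = λ x → S M x ⊎ x ≡ w }

forget : (M : Model) → W M → Model
forget M w = record { W = W M ; R = R M ; V = V M ; S = λ x → S M x × x ≢ w }

erase : Model → Model
erase M = record { W = W M ; R = R M ; V = V M ; S = λ _ → ⊥ }

PModel : Set₁
PModel = Σ Model W

data Form : Set where
  prop            : ℕ → Form
  ⊤f ⊥f           : Form
  ¬f              : Form → Form
  _∧f_ _∨f_ _⇒f_ _⇔f_ : Form → Form → Form
  k               : Form
  r f e           : Form → Form
  ⟨r⟩ ⟨⟨r⟩⟩       : Form → Form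

-- A memory logic: propositional connectives, k, r, and a chosen subset
-- of {f, e, ⟨r⟩, ⟨⟨r⟩⟩}.
record Logic : Set where
  field
    hasF hasE hasDia hasMDia : Bool
open Logic public

InL : Logic → Form → Set
InL L (prop _) = ⊤
InL L ⊤f = ⊤
InL L ⊥f = ⊤
InL L (¬f φ) = InL L φ
InL L (φ ∧f ψ) = InL L φ × InL L ψ
InL L (φ ∨f ψ) = InL L φ × InL L ψ
InL L (φ ⇒f ψ) = InL L φ × InL L ψ
InL L (φ ⇔f ψ) = InL L φ × InL L ψ
InL L k = ⊤
InL L (r φ) = InL L φ
InL L (f φ) = T (hasF L) × InL L φ
InL L (e φ) = T (hasE L) × InL L φ
InL L (⟨r⟩ φ) = T (hasDia L) × InL L φ
InL L (⟨⟨r⟩⟩ φ) = T (hasMDia L) × InL L φ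

_,_⊨_ : (M : Model) → W M → Form → Set
M , w ⊨ prop i = V M i w
M , w ⊨ ⊤f = ⊤
M , w ⊨ ⊥f = ⊥
M , w ⊨ ¬f φ = ¬ (M , w ⊨ φ)
M , w ⊨ (φ ∧f ψ) = (M , w ⊨ φ) × (M , w ⊨ ψ)
M , w ⊨ (φ ∨f ψ) = (M , w ⊨ φ) ⊎ (M , w ⊨ ψ)
M , w ⊨ (φ ⇒f ψ) = (M , w ⊨ φ) → (M , w ⊨ ψ)
M , w ⊨ (φ ⇔f ψ) = ((M , w ⊨ φ) → (M , w ⊨ ψ)) × ((M , w ⊨ ψ) → (M , w ⊨ φ))
M , w ⊨ k = S M w
M , w ⊨ r φ = remember M w , w ⊨ φ
M , w ⊨ f φ = forget M w , w ⊨ φ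
M , w ⊨ e φ = erase M , w ⊨ φ
M , w ⊨ ⟨r⟩ φ = Σ (W M) λ w' → R M w w' × (M , w' ⊨ φ)
M , w ⊨ ⟨⟨r⟩⟩ φ = Σ (W M) λ w' → R M w w' × (remember M w , w' ⊨ φ)

record IsSimulation (L : Logic) (Z : PModel → PModel → Set) : Set₁ where
  field
    nontriv : Σ PModel λ p → Σ PModel λ q → Z p q
    agree   : ∀ {M m N n} → Z (M , m) (N , n) → ∀ i → V M i m ⇔ V N i n
    kagree  : ∀ {M m N n} → Z (M , m) (N , n) → S M m ⇔ S N n
    r-clause : ∀ {M m N n} → Z (M , m) (N , n) → Z (remember M m , m) (remember N n , n)
    f-clause : T (hasF L) → ∀ {M m N n} → Z (M , m) (N , n) → Z (forget M m , m) (forget N n , n)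
    e-clause : T (hasE L) → ∀ {M m N n} → Z (M , m) (N , n) → Z (erase M , m) (erase N , n)
    forth : T (hasDia L) → ∀ {M m N n} → Z (M , m) (N , n) →
      ∀ m' → R M m m' → Σ (W N) λ n' → R N n n' × Z (M , m') (N , n')
    back  : T (hasDia L) → ∀ {M m N n} → Z (M , m) (N , n) →
      ∀ n' → R N n n' → Σ (W M) λ m' → R M m m' × Z (M , m') (N , n')
    mforth : T (hasMDia L) → ∀ {M m N n} → Z (M , m) (N , n) →
      ∀ m' → R M m m' → Σ (W N) λ n' → R N n n' × Z (remember M m , m') (remember N n , n')
    mback  : T (hasMDia L) → ∀ {M m N n} → Z (M , m) (N , n) →
      ∀ n' → R N n n' → Σ (W M) λ m' → R M m m' × Z (remember M m , m') (remember N n , n')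

data FO (n : ℕ) : Set where
  Rᶠ  : Fin n → Fin n → FO n
  Pᶠ  : ℕ → Fin n → FO n
  Kᶠ  : Fin n → FO n
  _≐_ : Fin n → Fin n → FO n
  ⊥ᶠ  : FO n
  ¬ᶠ  : FO n → FO n
  _∧ᶠ_ _∨ᶠ_ _⇒ᶠ_ : FO n → FO n → FO n
  ∃ᶠ ∀ᶠ : FO (suc n) → FO n

FOsat : (M : Model) {n : ℕ} → FO n → Vector (W M) n → Set
FOsat M (Rᶠ i j) ρ = R M (ρ i) (ρ j)
FOsat M (Pᶠ p i) ρ = V M p (ρ i)
FOsat M (Kᶠ i) ρ = S M (ρ i)
FOsat M (i ≐ j) ρ = ρ i ≡ ρ j
FOsat M ⊥ᶠ ρ = ⊥
FOsat M (¬ᶠ φ) ρ = ¬ FOsat M φ ρ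
FOsat M (φ ∧ᶠ ψ) ρ = FOsat M φ ρ × FOsat M ψ ρ
FOsat M (φ ∨ᶠ ψ) ρ = FOsat M φ ρ ⊎ FOsat M ψ ρ
FOsat M (φ ⇒ᶠ ψ) ρ = FOsat M φ ρ → FOsat M ψ ρ
FOsat M (∃ᶠ φ) ρ = Σ (W M) λ x → FOsat M φ (x ∷ ρ)
FOsat M (∀ᶠ φ) ρ = ∀ x → FOsat M φ (x ∷ ρ)

-- A type over a finite parameter set A = {a 0, …, a (n-1)}: a set Γ of formulas
-- in one free variable (variable 0) with parameters (variables 1..n interpreted by a).
FinitelyRealized : (M : Model) {n : ℕ} → Vector (W M) n → (FO (suc n) → Set) → Set
FinitelyRealized M {n} a Γ =
  (Δ : List (FO (suc n))) → All Γ Δ → Σ (W M) λ x → All (λ φ → FOsat M φ (x ∷ a)) Δ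

Realized : (M : Model) {n : ℕ} → Vector (W M) n → (FO (suc n) → Set) → Set
Realized M a Γ = Σ (W M) λ x → ∀ φ → Γ φ → FOsat M φ (x ∷ a)

OmegaSaturated : Model → Set₁
OmegaSaturated M = (n : ℕ) (a : Vector (W M) n) (Γ : FO (suc n) → Set) →
  FinitelyRealized M a Γ → Realized M a Γ

module Submission where

-- The simulation relates two pointed models when
-- (a) their memories are first-order definable with parameters over M resp. N
--     (frames and valuations being those of M resp. N), and
-- (b) the 𝔏-theory of the first point is included in that of the second.
-- It contains (M,w),(N,v) by hypothesis.  The memory clauses (r, f, e) preserve (a) since
-- adding, removing or erasing one element is definable from the old definition plus one
-- parameter, and they preserve (b) because r, f, e are operators of 𝔏.
-- The relation lives in Set₁; excluded middle squashes it into Set, as the statement requires.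

open import Defs
open import Level using (0ℓ; lift; lower) renaming (suc to lsuc)
open import Axiom.ExcludedMiddle using (ExcludedMiddle)
open import Axiom.DoubleNegationElimination using (DoubleNegationElimination; em⇒dne)
open import Data.Nat using (ℕ; zero; suc)
open import Data.Fin using (Fin; zero; suc)
open import Data.Bool using (T)
open import Data.Empty using (⊥)
open import Data.Unit using (tt)
open import Data.Product using (Σ; _×_; _,_; proj₂)
open import Data.Product.Function.NonDependent.Propositional using (_×-⇔_)
open import Data.Sum using (_⊎_; inj₁; inj₂)
open import Data.Sum.Function.Propositional using (_⊎-⇔_)
open import Data.List using (List; []; _∷_)
open import Data.List.Relation.Unary.All as All using (All; []; _∷_)
open import Data.Vec.Functional using (Vector) renaming (_∷_ to _∷ᵥ_; [] to []ᵥ)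
open import Function.Bundles using (_⇔_; mk⇔; Equivalence)
open import Function.Properties.Equivalence using (⇔-isEquivalence)
open import Function.Related.TypeIsomorphisms using (→-cong-⇔; ¬-cong-⇔)
open import Relation.Binary.Structures using (IsEquivalence)
open import Relation.Binary.PropositionalEquality using (_≡_; refl)
open import Relation.Nullary using (¬_)
open import Relation.Nullary.Decidable using (True; toWitness; fromWitness; map′)

open IsEquivalence (⇔-isEquivalence {ℓ = 0ℓ}) using ()
  renaming (refl to ⇔-refl; sym to ⇔-sym; trans to ⇔-trans)
open Equivalence using (to; from)

∃-cong : {A : Set} {P Q : A → Set} → (∀ x → P x ⇔ Q x) → Σ A P ⇔ Σ A Q
∃-cong P⇔Q = mk⇔ (λ (x , p) → x , to (P⇔Q x) p) (λ (x , q) → x , from (P⇔Q x) q)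

∀-cong : {A : Set} {P Q : A → Set} → (∀ x → P x ⇔ Q x) → ((x : A) → P x) ⇔ ((x : A) → Q x)
∀-cong P⇔Q = mk⇔ (λ p x → to (P⇔Q x) (p x)) (λ q x → from (P⇔Q x) (q x))

liftRen : ∀ {n m} → (Fin n → Fin m) → Fin (suc n) → Fin (suc m)
liftRen σ zero = zero
liftRen σ (suc i) = suc (σ i)

rename : ∀ {n m} → (Fin n → Fin m) → FO n → FO m
rename σ (Rᶠ i j) = Rᶠ (σ i) (σ j)
rename σ (Pᶠ p i) = Pᶠ p (σ i)
rename σ (Kᶠ i) = Kᶠ (σ i)
rename σ (i ≐ j) = σ i ≐ σ j
rename σ ⊥ᶠ = ⊥ᶠ
rename σ (¬ᶠ φ) = ¬ᶠ (rename σ φ)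
rename σ (φ ∧ᶠ ψ) = rename σ φ ∧ᶠ rename σ ψ
rename σ (φ ∨ᶠ ψ) = rename σ φ ∨ᶠ rename σ ψ
rename σ (φ ⇒ᶠ ψ) = rename σ φ ⇒ᶠ rename σ ψ
rename σ (∃ᶠ φ) = ∃ᶠ (rename (liftRen σ) φ)
rename σ (∀ᶠ φ) = ∀ᶠ (rename (liftRen σ) φ)

AgreeAlong : {A : Set} {n m : ℕ} → (Fin n → Fin m) → Vector A m → Vector A n → Set
AgreeAlong σ ρ ρ' = ∀ i → ρ (σ i) ≡ ρ' i

liftRen-agrees : {A : Set} {n m : ℕ} {σ : Fin n → Fin m} {ρ : Vector A m} {ρ' : Vector A n} →
  AgreeAlong σ ρ ρ' → (x : A) → AgreeAlong (liftRen σ) (x ∷ᵥ ρ) (x ∷ᵥ ρ')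
liftRen-agrees agree x zero = refl
liftRen-agrees agree x (suc i) = agree i

rename-sound : (M : Model) {n m : ℕ} (σ : Fin n → Fin m) {ρ : Vector (W M) m} {ρ' : Vector (W M) n} →
  AgreeAlong σ ρ ρ' → (φ : FO n) → FOsat M (rename σ φ) ρ ⇔ FOsat M φ ρ'
rename-sound M σ agree (Rᶠ i j) rewrite agree i | agree j = ⇔-refl
rename-sound M σ agree (Pᶠ p i) rewrite agree i = ⇔-refl
rename-sound M σ agree (Kᶠ i) rewrite agree i = ⇔-refl
rename-sound M σ agree (i ≐ j) rewrite agree i | agree j = ⇔-refl
rename-sound M σ agree ⊥ᶠ = ⇔-refl
rename-sound M σ agree (¬ᶠ φ) = ¬-cong-⇔ (rename-sound M σ agree φ)
rename-sound M σ agree (φ ∧ᶠ ψ) = rename-sound M σ agree φ ×-⇔ rename-sound M σ agree ψ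
rename-sound M σ agree (φ ∨ᶠ ψ) = rename-sound M σ agree φ ⊎-⇔ rename-sound M σ agree ψ
rename-sound M σ agree (φ ⇒ᶠ ψ) = →-cong-⇔ (rename-sound M σ agree φ) (rename-sound M σ agree ψ)
rename-sound M σ agree (∃ᶠ φ) = ∃-cong λ x → rename-sound M (liftRen σ) (liftRen-agrees agree x) φ
rename-sound M σ agree (∀ᶠ φ) = ∀-cong λ x → rename-sound M (liftRen σ) (liftRen-agrees agree x) φ

withMemory : (M : Model) → (W M → Set) → Model
withMemory M S' = record { W = W M ; R = R M ; V = V M ; S = S' }

-- μ, whose variable 0 is the tested element and whose other variables are the
-- parameters ρ, defines the memory S' of B.
record Defines (B : Model) {n : ℕ} (μ : FO (suc n)) (ρ : Vector (W B) n) (S' : W B → Set) : Set where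
  constructor defining
  field membership : ∀ x → S' x ⇔ FOsat B μ (x ∷ᵥ ρ)
open Defines

weakenMemory : ∀ {n} → FO (suc n) → FO (suc (suc n))
weakenMemory μ = rename (liftRen suc) μ

addToMemory : ∀ {n} → FO (suc n) → Fin n → FO (suc n)
addToMemory μ i = μ ∨ᶠ (zero ≐ suc i)

removeFromMemory : ∀ {n} → FO (suc n) → Fin n → FO (suc n)
removeFromMemory μ i = μ ∧ᶠ ¬ᶠ (zero ≐ suc i)

defines-rename : (B : Model) {n m : ℕ} {μ : FO (suc n)} {ρ : Vector (W B) n} {S' : W B → Set}
  (σ : Fin n → Fin m) {ρ' : Vector (W B) m} → AgreeAlong σ ρ' ρ →
  Defines B μ ρ S' → Defines B (rename (liftRen σ) μ) ρ' S'
defines-rename B {μ = μ} σ agree def = defining λ x →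
  ⇔-trans (membership def x) (⇔-sym (rename-sound B (liftRen σ) (liftRen-agrees agree x) μ))

defines-weaken : (B : Model) {n : ℕ} {μ : FO (suc n)} {ρ : Vector (W B) n} {S' : W B → Set} →
  Defines B μ ρ S' → (b : W B) → Defines B (weakenMemory μ) (b ∷ᵥ ρ) S'
defines-weaken B def b = defines-rename B suc (λ _ → refl) def

defines-add : (B : Model) {n : ℕ} {μ : FO (suc n)} {ρ : Vector (W B) n} {S' : W B → Set} →
  Defines B μ ρ S' → (i : Fin n) → Defines B (addToMemory μ i) ρ (λ x → S' x ⊎ x ≡ ρ i)
defines-add B def i = defining λ x → membership def x ⊎-⇔ ⇔-refl

defines-remove : (B : Model) {n : ℕ} {μ : FO (suc n)} {ρ : Vector (W B) n} {S' : W B → Set} →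
  Defines B μ ρ S' → (i : Fin n) → Defines B (removeFromMemory μ i) ρ (λ x → S' x × ¬ x ≡ ρ i)
defines-remove B def i = defining λ x → membership def x ×-⇔ ⇔-refl

defines-empty : (B : Model) {n : ℕ} {ρ : Vector (W B) n} → Defines B ⊥ᶠ ρ (λ _ → ⊥)
defines-empty B = defining λ _ → ⇔-refl

at : ∀ {n} → Fin n → Fin (suc n) → Fin n
at i zero = i
at i (suc j) = j

-- translate φ μ i is true under ρ iff φ holds at ρ i when the memory is defined by μ.
translate : ∀ {n} → Form → FO (suc n) → Fin n → FO n
translate (prop p) μ i = Pᶠ p i
translate ⊤f μ i = ¬ᶠ ⊥ᶠ
translate ⊥f μ i = ⊥ᶠ
translate (¬f φ) μ i = ¬ᶠ (translate φ μ i)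
translate (φ ∧f ψ) μ i = translate φ μ i ∧ᶠ translate ψ μ i
translate (φ ∨f ψ) μ i = translate φ μ i ∨ᶠ translate ψ μ i
translate (φ ⇒f ψ) μ i = translate φ μ i ⇒ᶠ translate ψ μ i
translate (φ ⇔f ψ) μ i = (translate φ μ i ⇒ᶠ translate ψ μ i) ∧ᶠ (translate ψ μ i ⇒ᶠ translate φ μ i)
translate k μ i = rename (at i) μ
translate (r φ) μ i = translate φ (addToMemory μ i) i
translate (f φ) μ i = translate φ (removeFromMemory μ i) i
translate (e φ) μ i = translate φ ⊥ᶠ i
translate (⟨r⟩ φ) μ i = ∃ᶠ (Rᶠ (suc i) zero ∧ᶠ translate φ (weakenMemory μ) zero)
translate (⟨⟨r⟩⟩ φ) μ i = ∃ᶠ (Rᶠ (suc i) zero ∧ᶠ translate φ (addToMemory (weakenMemory μ) (suc i)) zero)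

translate-sound : (B : Model) (φ : Form) {n : ℕ} {μ : FO (suc n)} {ρ : Vector (W B) n} {S' : W B → Set} →
  Defines B μ ρ S' → (i : Fin n) → (withMemory B S' , ρ i ⊨ φ) ⇔ FOsat B (translate φ μ i) ρ
translate-sound B (prop p) def i = ⇔-refl
translate-sound B ⊤f def i = mk⇔ (λ _ ()) (λ _ → tt)
translate-sound B ⊥f def i = ⇔-refl
translate-sound B (¬f φ) def i = ¬-cong-⇔ (translate-sound B φ def i)
translate-sound B (φ ∧f ψ) def i = translate-sound B φ def i ×-⇔ translate-sound B ψ def i
translate-sound B (φ ∨f ψ) def i = translate-sound B φ def i ⊎-⇔ translate-sound B ψ def i
translate-sound B (φ ⇒f ψ) def i = →-cong-⇔ (translate-sound B φ def i) (translate-sound B ψ def i)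
translate-sound B (φ ⇔f ψ) def i = →-cong-⇔ φ⇔ ψ⇔ ×-⇔ →-cong-⇔ ψ⇔ φ⇔
  where
  φ⇔ = translate-sound B φ def i
  ψ⇔ = translate-sound B ψ def i
translate-sound B k {μ = μ} {ρ} def i = ⇔-trans (membership def (ρ i)) (⇔-sym (rename-sound B (at i) agree μ))
  where
  agree : AgreeAlong (at i) ρ (ρ i ∷ᵥ ρ)
  agree zero = refl
  agree (suc j) = refl
translate-sound B (r φ) def i = translate-sound B φ (defines-add B def i) i
translate-sound B (f φ) def i = translate-sound B φ (defines-remove B def i) i
translate-sound B (e φ) def i = translate-sound B φ (defines-empty B) i
translate-sound B (⟨r⟩ φ) def i =
  ∃-cong λ x → ⇔-refl ×-⇔ translate-sound B φ (defines-weaken B def x) zero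
translate-sound B (⟨⟨r⟩⟩ φ) def i =
  ∃-cong λ x → ⇔-refl ×-⇔ translate-sound B φ (defines-add B (defines-weaken B def x) (suc i)) zero

record Definable (M M' : Model) : Set₁ where
  constructor definable
  field
    arity    : ℕ
    memory   : W M → Set
    is-model : M' ≡ withMemory M memory
    params   : Vector (W M) arity
    formula  : FO (suc arity)
    defines  : Defines M formula params memory

definable-self : (M : Model) → Definable M M
definable-self M = definable 0 (S M) refl []ᵥ (Kᶠ zero) (defining λ _ → ⇔-refl)

definable-remember : {M M' : Model} → Definable M M' → (m : W M') → Definable M (remember M' m)
definable-remember {M} (definable n S' refl c μ def) m =
  definable (suc n) _ refl (m ∷ᵥ c) (addToMemory (weakenMemory μ) zero)
    (defines-add M (defines-weaken M def m) zero)

definable-forget : {M M' : Model} → Definable M M' → (m : W M') → Definable M (forget M' m)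
definable-forget {M} (definable n S' refl c μ def) m =
  definable (suc n) _ refl (m ∷ᵥ c) (removeFromMemory (weakenMemory μ) zero)
    (defines-remove M (defines-weaken M def m) zero)

definable-erase : {M M' : Model} → Definable M M' → Definable M (erase M')
definable-erase {M} (definable n S' refl c μ def) = definable 0 _ refl []ᵥ ⊥ᶠ (defines-empty M)

-- The successors satisfying Γ are the realisations of a first-order type with parameters b, c.
modally-saturated : {M B : Model} → OmegaSaturated M → Definable M B → (b : W B) (Γ : Form → Set) →
  ((Δ : List Form) → All Γ Δ → Σ (W B) λ b' → R B b b' × All (λ ψ → B , b' ⊨ ψ) Δ) →
  Σ (W B) λ b' → R B b b' × (∀ ψ → Γ ψ → B , b' ⊨ ψ)
modally-saturated {M} sat (definable n S' refl c μ def) b Γ finite =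
  successor-realizing (sat (suc n) (b ∷ᵥ c) type finitely-realized)
  where
  -- the memory formula, weakened past the parameter b and the successor variable
  μ' : FO (suc (suc (suc n)))
  μ' = weakenMemory (weakenMemory μ)

  translation-at : ∀ ψ x → (withMemory M S' , x ⊨ ψ) ⇔ FOsat M (translate ψ μ' zero) (x ∷ᵥ b ∷ᵥ c)
  translation-at ψ x = translate-sound M ψ (defines-weaken M (defines-weaken M def b) x) zero

  successorOf : Form → FO (suc (suc n))
  successorOf ψ = Rᶠ (suc zero) zero ∧ᶠ translate ψ μ' zero

  type : FO (suc (suc n)) → Set
  type χ = χ ≡ Rᶠ (suc zero) zero ⊎ Σ Form λ ψ → Γ ψ × χ ≡ successorOf ψ

  modal-part : ∀ {Δ} → All type Δ → Σ (List Form) λ Δ' → All Γ Δ' ×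
    (∀ x → R M b x → All (λ ψ → withMemory M S' , x ⊨ ψ) Δ' → All (λ χ → FOsat M χ (x ∷ᵥ b ∷ᵥ c)) Δ)
  modal-part [] = [] , [] , λ _ _ _ → []
  modal-part (inj₁ refl ∷ pf) with modal-part pf
  ... | Δ' , γs , realizes = Δ' , γs , λ x bRx ss → bRx ∷ realizes x bRx ss
  modal-part (inj₂ (ψ , γ , refl) ∷ pf) with modal-part pf
  ... | Δ' , γs , realizes = ψ ∷ Δ' , γ ∷ γs , λ where
    x bRx (s ∷ ss) → (bRx , to (translation-at ψ x) s) ∷ realizes x bRx ss

  finitely-realized : FinitelyRealized M (b ∷ᵥ c) type
  finitely-realized Δ pf with modal-part pf
  ... | Δ' , γs , realizes with finite Δ' γs
  ... | x , bRx , ss = x , realizes x bRx ss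

  successor-realizing : Realized M (b ∷ᵥ c) type →
    Σ (W M) λ b' → R M b b' × (∀ ψ → Γ ψ → withMemory M S' , b' ⊨ ψ)
  successor-realizing (x , realizes-type) =
    x , realizes-type _ (inj₁ refl) ,
    λ ψ γ → from (translation-at ψ x) (proj₂ (realizes-type (successorOf ψ) (inj₂ (ψ , γ , refl))))

TheoryIncluded : Logic → PModel → PModel → Set
TheoryIncluded L (A , a) (B , b) = ∀ φ → InL L φ → A , a ⊨ φ → B , b ⊨ φ

-- Classically, theory inclusion is symmetric since 𝔏 is closed under negation.
theoryIncluded-sym : DoubleNegationElimination 0ℓ → (L : Logic) {p q : PModel} →
  TheoryIncluded L p q → TheoryIncluded L q p
theoryIncluded-sym dne L p⊆q φ φ∈L q⊨φ = dne λ p⊭φ → p⊆q (¬f φ) φ∈L p⊭φ q⊨φ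

conj : List Form → Form
conj [] = ⊤f
conj (φ ∷ Δ) = φ ∧f conj Δ

conj-InL : (L : Logic) {Δ : List Form} → All (InL L) Δ → InL L (conj Δ)
conj-InL L [] = tt
conj-InL L (φ∈L ∷ Δ⊆L) = φ∈L , conj-InL L Δ⊆L

⊨-conj : (M : Model) (w : W M) (Δ : List Form) → (M , w ⊨ conj Δ) ⇔ All (λ φ → M , w ⊨ φ) Δ
⊨-conj M w [] = mk⇔ (λ _ → []) (λ _ → tt)
⊨-conj M w (φ ∷ Δ) =
  mk⇔ (λ (s , ss) → s ∷ to (⊨-conj M w Δ) ss) (λ where (s ∷ ss) → s , from (⊨-conj M w Δ) ss)

theory-successor : {M B : Model} → OmegaSaturated M → Definable M B → (L : Logic) (b : W B)
  (A : Model) (a' : W A) →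
  ((Δ : List Form) → InL L (conj Δ) → A , a' ⊨ conj Δ → Σ (W B) λ b' → R B b b' × B , b' ⊨ conj Δ) →
  Σ (W B) λ b' → R B b b' × TheoryIncluded L (A , a') (B , b')
theory-successor {B = B} sat defB L b A a' finite
  with modally-saturated sat defB b (λ ψ → InL L ψ × A , a' ⊨ ψ) finite-theory
  where
  finite-theory : (Δ : List Form) → All (λ ψ → InL L ψ × A , a' ⊨ ψ) Δ →
    Σ (W B) λ b' → R B b b' × All (λ ψ → B , b' ⊨ ψ) Δ
  finite-theory Δ Δ⊆Th with All.unzip Δ⊆Th
  ... | Δ⊆L , Δ-true with finite Δ (conj-InL L Δ⊆L) (from (⊨-conj A a' Δ) Δ-true)
  ... | b' , bRb' , b'⊨Δ = b' , bRb' , to (⊨-conj B b' Δ) b'⊨Δ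
... | b' , bRb' , b'⊨Th = b' , bRb' , λ φ φ∈L a'⊨φ → b'⊨Th φ (φ∈L , a'⊨φ)

diamond-step : {M B : Model} → OmegaSaturated M → Definable M B → (L : Logic) → T (hasDia L) →
  {A : Model} {a : W A} {b : W B} → TheoryIncluded L (A , a) (B , b) →
  (a' : W A) → R A a a' → Σ (W B) λ b' → R B b b' × TheoryIncluded L (A , a') (B , b')
diamond-step sat defB L hasDia {A} {a} {b} a⊆b a' aRa' =
  theory-successor sat defB L b A a' λ Δ Δ∈L a'⊨Δ → a⊆b (⟨r⟩ (conj Δ)) (hasDia , Δ∈L) (a' , aRa' , a'⊨Δ)

memory-diamond-step : {M B : Model} → OmegaSaturated M → Definable M B → (L : Logic) → T (hasMDia L) →
  {A : Model} {a : W A} {b : W B} → TheoryIncluded L (A , a) (B , b) →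
  (a' : W A) → R A a a' →
  Σ (W B) λ b' → R B b b' × TheoryIncluded L (remember A a , a') (remember B b , b')
memory-diamond-step sat defB L hasMDia {A} {a} {b} a⊆b a' aRa' =
  theory-successor sat (definable-remember defB b) L b (remember A a) a'
    λ Δ Δ∈L a'⊨Δ → a⊆b (⟨⟨r⟩⟩ (conj Δ)) (hasMDia , Δ∈L) (a' , aRa' , a'⊨Δ)

em₁⇒dne₀ : ExcludedMiddle (lsuc 0ℓ) → DoubleNegationElimination 0ℓ
em₁⇒dne₀ em = em⇒dne (map′ lower lift em)

module Construction (em : ExcludedMiddle (lsuc 0ℓ)) (L : Logic) (M N : Model)
                    (satM : OmegaSaturated M) (satN : OmegaSaturated N) where

  Related : PModel → PModel → Set₁
  Related (M' , m) (N' , n) = Definable M M' × Definable N N' × TheoryIncluded L (M' , m) (N' , n)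

  -- Related, squashed into Set by deciding it.
  Z : PModel → PModel → Set
  Z p q = True (em {Related p q})

  squash : ∀ {p q} → Related p q → Z p q
  squash {p} {q} = fromWitness {a? = em {Related p q}}

  unsquash : ∀ {p q} → Z p q → Related p q
  unsquash {p} {q} = toWitness {a? = em {Related p q}}

  -- Theory inclusion between related points is in fact theory equality.
  reverse : ∀ {p q} → TheoryIncluded L p q → TheoryIncluded L q p
  reverse = theoryIncluded-sym (em₁⇒dne₀ em) L

  open IsSimulation

  simulation : ∀ {p q} → Z p q → IsSimulation L Z
  simulation {p} {q} z .nontriv = p , q , z
  simulation z .agree z' i with unsquash z'
  ... | _ , _ , m⊆n = mk⇔ (m⊆n (prop i) tt) (reverse m⊆n (prop i) tt)
  simulation z .kagree z' with unsquash z'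
  ... | _ , _ , m⊆n = mk⇔ (m⊆n k tt) (reverse m⊆n k tt)
  simulation z .r-clause {m = m} {n = n} z' with unsquash z'
  ... | dM , dN , m⊆n = squash (definable-remember dM m , definable-remember dN n , λ φ → m⊆n (r φ))
  simulation z .f-clause hasF {m = m} {n = n} z' with unsquash z'
  ... | dM , dN , m⊆n =
    squash (definable-forget dM m , definable-forget dN n , λ φ φ∈L → m⊆n (f φ) (hasF , φ∈L))
  simulation z .e-clause hasE z' with unsquash z'
  ... | dM , dN , m⊆n = squash (definable-erase dM , definable-erase dN , λ φ φ∈L → m⊆n (e φ) (hasE , φ∈L))
  simulation z .forth hasDia z' m' mRm' with unsquash z'
  ... | dM , dN , m⊆n with diamond-step satN dN L hasDia m⊆n m' mRm'
  ... | n' , nRn' , m'⊆n' = n' , nRn' , squash (dM , dN , m'⊆n')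
  simulation z .back hasDia z' n' nRn' with unsquash z'
  ... | dM , dN , m⊆n with diamond-step satM dM L hasDia (reverse m⊆n) n' nRn'
  ... | m' , mRm' , n'⊆m' = m' , mRm' , squash (dM , dN , reverse n'⊆m')
  simulation z .mforth hasMDia {m = m} {n = n} z' m' mRm' with unsquash z'
  ... | dM , dN , m⊆n with memory-diamond-step satN dN L hasMDia m⊆n m' mRm'
  ... | n' , nRn' , m'⊆n' = n' , nRn' , squash (definable-remember dM m , definable-remember dN n , m'⊆n')
  simulation z .mback hasMDia {m = m} {n = n} z' n' nRn' with unsquash z'
  ... | dM , dN , m⊆n
    with memory-diamond-step satM dM L hasMDia (reverse m⊆n) n' nRn'
  ... | m' , mRm' , n'⊆m' =
    m' , mRm' , squash (definable-remember dM m , definable-remember dN n , reverse n'⊆m')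

theorem5p2 : ExcludedMiddle (lsuc 0ℓ) →
    (L : Logic) (M N : Model) (w : W M) (v : W N) →
    OmegaSaturated M → OmegaSaturated N →
    ((φ : Form) → InL L φ → M , w ⊨ φ → N , v ⊨ φ) →
    Σ (PModel → PModel → Set) λ Z → IsSimulation L Z × Z (M , w) (N , v)
theorem5p2 em L M N w v satM satN w⊆v = Z , simulation related , related
  where
  open Construction em L M N satM satN
  related : Z (M , w) (N , v)
  related = squash (definable-self M , definable-self N , w⊆v)
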